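{- If $G$ is a finite simple graph, then $\mathrm{mof}(G) = \rho(G)$, where $\rho(G)$ is the minimum number of vertex-disjoint paths in $G$ that cover all vertices of $G$.
   Context: An orientation $D$ of a simple graph $G$ assigns to each edge exactly one direction; if $(u,v)$ is an arc, $v$ is an out-neighbor of $u$. Oriented $1$-forcing: starting from a nonempty set $S$ of colored vertices, repeatedly, any colored vertex with at most one non-colored out-neighbor forces that out-neighbor to become colored (all forcings in a step simultaneous), until no change occurs; $S$ is a forcing set if all vertices end up colored. $F(D)$ is the minimum size of a forcing set of $D$, and $\mathrm{mof}(G)$ is the minimum of $F(D)$ over all orientations $D$ of $G$. Paths here may consist of a single vertex. -}

module Defs where

open import Data.Nat using (ℕ; zero; suc; _≤_)
open import Data.Bool using (Bool; true; false)
open import Data.Fin using (Fin)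
open import Data.Fin.Subset using (Subset; _∈_; ∣_∣; Nonempty)
open import Data.List using (List; []; _∷_; length; concat; allFin)
open import Data.List.Relation.Unary.All using (All)
open import Data.List.Relation.Unary.Linked using (Linked)
open import Data.List.Relation.Binary.Permutation.Propositional using (_↭_)
open import Data.Product using (Σ; _×_; ∃; ∃-syntax)
open import Data.Sum using (_⊎_)
open import Data.Empty using (⊥)
open import Relation.Binary.PropositionalEquality using (_≡_; _≢_)

record Graph (n : ℕ) : Set where
  field
    adj     : Fin n → Fin n → Bool
    adj-sym : ∀ u v → adj u v ≡ adj v u
    adj-irr : ∀ v → adj v v ≡ false

open Graph public

Edge : ∀ {n} → Graph n → Fin n → Fin n → Set
Edge G u v = adj G u v ≡ true

record Orientation {n : ℕ} (G : Graph n) : Set where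
  field
    arc         : Fin n → Fin n → Bool
    arc-edge    : ∀ u v → arc u v ≡ true → Edge G u v
    arc-one-dir : ∀ u v → Edge G u v →
                  (arc u v ≡ true × arc v u ≡ false) ⊎ (arc u v ≡ false × arc v u ≡ true)

open Orientation public

Arc : ∀ {n} {G : Graph n} → Orientation G → Fin n → Fin n → Set
Arc D u v = arc D u v ≡ true

-- ColoredAt D S k v : vertex v is colored after k simultaneous forcing steps
-- of oriented 1-forcing starting from S.
data ColoredAt {n : ℕ} {G : Graph n} (D : Orientation G) (S : Subset n)
     : ℕ → Fin n → Set where
  init  : ∀ {v} → v ∈ S → ColoredAt D S zero v
  keep  : ∀ {k v} → ColoredAt D S k v → ColoredAt D S (suc k) v
  force : ∀ {k u v} → ColoredAt D S k u → Arc D u v →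
          (∀ w → Arc D u w → w ≢ v → ColoredAt D S k w) →
          ColoredAt D S (suc k) v

IsForcingSet : ∀ {n} {G : Graph n} → Orientation G → Subset n → Set
IsForcingSet {n} D S = Nonempty S × ∃[ k ] (∀ (v : Fin n) → ColoredAt D S k v)

IsMof : ∀ {n} → Graph n → ℕ → Set
IsMof G m =
  (Σ (Orientation G) λ D → Σ (Subset _) λ S → IsForcingSet D S × ∣ S ∣ ≡ m)
  × (∀ (D : Orientation G) (S : Subset _) → IsForcingSet D S → m ≤ ∣ S ∣)

-- A path in G: a nonempty list of vertices, consecutive ones adjacent
-- (distinctness of vertices is enforced by the path cover condition below).
IsPath : ∀ {n} → Graph n → List (Fin n) → Set
IsPath G []      = ⊥
IsPath G (x ∷ xs) = Linked (Edge G) (x ∷ xs)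

-- A vertex-disjoint path cover: a list of paths whose concatenation lists
-- every vertex exactly once.
IsPathCover : ∀ {n} → Graph n → List (List (Fin n)) → Set
IsPathCover {n} G ps = All (IsPath G) ps × (concat ps ↭ allFin n)

IsRho : ∀ {n} → Graph n → ℕ → Set
IsRho G r =
  (Σ (List (List (Fin _))) λ ps → IsPathCover G ps × length ps ≡ r)
  × (∀ ps → IsPathCover G ps → r ≤ length ps)

-- Both mof(G) and ρ(G) equal the least number of maximal G-paths ("runs")
-- into which some ordering of V(G) splits.
--
-- Given an ordering, orient each edge between consecutive vertices forwards
-- and every other edge backwards, and colour the first vertex of every run:
-- then the vertex at position j is coloured at step j, because its
-- predecessor's only out-neighbour that does not precede it is the vertex
-- itself.  Conversely, given a forcing set S of any orientation, the forcing
-- process can be replayed while maintaining |S| vertex-disjoint paths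
-- ("forcing chains") covering the coloured vertices: a vertex is only ever
-- forced by the current end of its chain, since every earlier vertex of a
-- chain has already forced and hence has all its out-neighbours coloured.

module Submission where

open import Defs
open import Data.Bool using (Bool; true; false; _∧_)
import Data.Bool.Properties as Bool
open import Data.Fin using (Fin; zero; suc)
open import Data.Fin.Properties using (any?; all?) renaming (_≟_ to _≟ᶠ_)
import Data.Fin.Properties as Fin
open import Data.Vec using ([]; _∷_)
open import Data.Fin.Subset using (Subset; ⁅_⁆; _∪_; ∣_∣) renaming (_∈_ to _∈ₛ_; ⊥ to ∅)
open import Data.Fin.Subset.Properties using (∣⁅x⁆∣≡1; ∣⊥∣≡0; x∈⁅x⁆; x∈p∪q⁺; drop-there)
open import Data.List using (List; []; _∷_; [_]; _++_; length; concat; map; allFin)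
open import Data.List.Properties using (length-++; length-map; length-tabulate; concat-++; concat-map-[_])
open import Data.List.Relation.Unary.All as All using (All; []; _∷_)
import Data.List.Relation.Unary.All.Properties as All
open import Data.List.Relation.Unary.All.Properties using (++⁺; ++⁻; ++⁻ʳ; ¬Any⇒All¬)
open import Data.List.Relation.Unary.Any using (here; there)
open import Data.List.Relation.Unary.Linked using ([-]; _∷_)
open import Data.List.Relation.Unary.Unique.Propositional using (Unique; []; _∷_)
open import Data.List.Relation.Unary.Unique.Propositional.Properties using (allFin⁺)
import Data.List.Relation.Unary.Unique.Propositional.Properties as Unique
open import Data.List.Relation.Unary.Unique.DecPropositional using (unique?)
open import Data.List.Membership.Propositional using (_∈_; _∉_)
open import Data.List.Membership.Propositional.Properties using (∈-allFin; ∈-map⁺; ∈-∃++; ∈-concat⁻′)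
open import Data.List.Membership.DecPropositional using (_∈?_)
open import Data.List.Membership.Propositional.Properties.WithK using (unique∧set⇒bag)
open import Data.List.Relation.Binary.Subset.Propositional using (_⊆_)
open import Data.List.Relation.Binary.BagAndSetEquality using (∼bag⇒↭)
open import Data.List.Relation.Binary.Permutation.Propositional
  using (_↭_; ↭-refl; ↭-sym; ↭⇒↭ₛ; module PermutationReasoning)
open import Data.List.Relation.Binary.Permutation.Propositional.Properties
  using (∈-resp-↭; ↭-length; shift)
open import Data.List.Relation.Binary.Permutation.Setoid.Properties using (Unique-resp-↭)
open import Data.Nat using (ℕ; zero; suc; _+_; _≤_; _<_; _≤′_; ≤′-reflexive; ≤′-step; z≤n; s≤s)
open import Data.Nat.Properties
  using ( _≟_; suc-injective; ≤-refl; ≤-reflexive; ≤-trans; ≤-antisym; <⇒≤; ≮⇒≥; n≤1+n; m<n⇒m<1+n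
        ; 0≢1+n; +-suc; +-monoʳ-≤; ≤⇒≤′; anyUpTo?; module ≤-Reasoning)
open import Data.Nat.Induction using (<-rec)
open import Data.Product using (Σ; ∃; ∃₂; _×_; _,_; proj₂)
open import Data.Sum using (_⊎_; inj₁; inj₂; map₂)
open import Data.Unit using (⊤)
open import Function using (_∘_)
open import Function.Bundles using (mk⇔)
open import Relation.Binary.Definitions using (DecidableEquality)
open import Relation.Binary.PropositionalEquality using (_≡_; _≢_; refl; sym; trans; cong; subst; setoid)
open import Relation.Nullary using (Dec; yes; no; ¬?; contradiction)
open import Relation.Nullary.Decidable using (map′; _×-dec_; _→-dec_)
open import Relation.Unary using (Pred; Decidable)
open import Level using (0ℓ)

least : {P : Pred ℕ 0ℓ} → Decidable P → ∀ r → P r → ∃ λ k → P k × (∀ j → P j → k ≤ j)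
least {P} P? = <-rec _ minimise
  where
  minimise : ∀ r → (∀ {j} → j < r → P j → ∃ λ k → P k × (∀ j → P j → k ≤ j)) →
             P r → ∃ λ k → P k × (∀ j → P j → k ≤ j)
  minimise r smaller pr with anyUpTo? P? r
  ... | yes (j , j<r , pj) = smaller j<r pj
  ... | no none            = r , pr , λ j pj → ≮⇒≥ (λ j<r → none (j , j<r , pj))

any-ofLength? : ∀ {m} {P : Pred (List (Fin m)) 0ℓ} → Decidable P →
                ∀ k → Dec (∃ λ xs → length xs ≡ k × P xs)
any-ofLength? P? zero = map′ (λ p → [] , refl , p) (λ { ([] , _ , p) → p ; (_ ∷ _ , () , _) }) (P? [])
any-ofLength? P? (suc k) =
  map′ (λ (x , xs , len , p) → x ∷ xs , cong suc len , p)
       (λ { ([] , () , _) ; (x ∷ xs , len , p) → x , xs , suc-injective len , p })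
       (any? λ x → any-ofLength? (P? ∘ (x ∷_)) k)

module _ {m : ℕ} {xs : List (Fin m)} where

  ↭-allFin⁺ : Unique xs → (∀ v → v ∈ xs) → xs ↭ allFin m
  ↭-allFin⁺ unique complete =
    ∼bag⇒↭ (unique∧set⇒bag unique (allFin⁺ m) (mk⇔ (λ _ → ∈-allFin _) (λ _ → complete _)))

  ↭-allFin⇒Unique : xs ↭ allFin m → Unique xs
  ↭-allFin⇒Unique perm = Unique-resp-↭ (setoid (Fin m)) (↭⇒↭ₛ (↭-sym perm)) (allFin⁺ m)

  ↭-allFin⇒∈ : xs ↭ allFin m → ∀ v → v ∈ xs
  ↭-allFin⇒∈ perm v = ∈-resp-↭ (↭-sym perm) (∈-allFin v)

  ↭-allFin⇒length : xs ↭ allFin m → length xs ≡ m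
  ↭-allFin⇒length perm = trans (↭-length perm) (length-tabulate _)

↭-allFin? : ∀ {m} (xs : List (Fin m)) → Dec (xs ↭ allFin m)
↭-allFin? xs with unique? _≟ᶠ_ xs | all? (λ v → _∈?_ _≟ᶠ_ v xs)
... | yes unique | yes complete = yes (↭-allFin⁺ unique complete)
... | no ¬unique | _            = no (¬unique ∘ ↭-allFin⇒Unique)
... | yes _      | no ¬complete = no (¬complete ∘ ↭-allFin⇒∈)

module _ {A : Set} where

  concat-consAt : ∀ (as bs : List (List A)) v p → concat (as ++ (v ∷ p) ∷ bs) ↭ v ∷ concat (as ++ p ∷ bs)
  concat-consAt as bs v p = begin
    concat (as ++ (v ∷ p) ∷ bs)         ≡⟨ concat-++ as ((v ∷ p) ∷ bs) ⟨
    concat as ++ v ∷ p ++ concat bs     ↭⟨ shift v (concat as) (p ++ concat bs) ⟩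
    v ∷ concat as ++ p ++ concat bs     ≡⟨ cong (v ∷_) (concat-++ as (p ∷ bs)) ⟩
    v ∷ concat (as ++ p ∷ bs)           ∎
    where open PermutationReasoning

  length-replaceAt : ∀ (as : List A) {bs p q} → length (as ++ q ∷ bs) ≡ length (as ++ p ∷ bs)
  length-replaceAt as = trans (length-++ as) (sym (length-++ as))

  module _ {P : Pred A 0ℓ} where

    All-at : ∀ as {bs p} → All P (as ++ p ∷ bs) → P p
    All-at as = All.head ∘ ++⁻ʳ as

    All-replaceAt : ∀ as {bs p q} → All P (as ++ p ∷ bs) → P q → All P (as ++ q ∷ bs)
    All-replaceAt as all pq with ++⁻ as all
    ... | pas , _ ∷ pbs = ++⁺ pas (pq ∷ pbs)

∣p∪q∣≤∣p∣+∣q∣ : ∀ {m} (p q : Subset m) → ∣ p ∪ q ∣ ≤ ∣ p ∣ + ∣ q ∣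
∣p∪q∣≤∣p∣+∣q∣ []          []          = z≤n
∣p∪q∣≤∣p∣+∣q∣ (true ∷ p)  (true ∷ q)  = s≤s (≤-trans (∣p∪q∣≤∣p∣+∣q∣ p q) (+-monoʳ-≤ ∣ p ∣ (n≤1+n _)))
∣p∪q∣≤∣p∣+∣q∣ (true ∷ p)  (false ∷ q) = s≤s (∣p∪q∣≤∣p∣+∣q∣ p q)
∣p∪q∣≤∣p∣+∣q∣ (false ∷ p) (true ∷ q)  = ≤-trans (s≤s (∣p∪q∣≤∣p∣+∣q∣ p q)) (≤-reflexive (sym (+-suc ∣ p ∣ ∣ q ∣)))
∣p∪q∣≤∣p∣+∣q∣ (false ∷ p) (false ∷ q) = ∣p∪q∣≤∣p∣+∣q∣ p q

fromList : ∀ {m} → List (Fin m) → Subset m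
fromList []       = ∅
fromList (x ∷ xs) = ⁅ x ⁆ ∪ fromList xs

∣fromList∣≤length : ∀ {m} (xs : List (Fin m)) → ∣ fromList xs ∣ ≤ length xs
∣fromList∣≤length {m} [] = ≤-reflexive (∣⊥∣≡0 m)
∣fromList∣≤length (x ∷ xs) = begin
  ∣ ⁅ x ⁆ ∪ fromList xs ∣         ≤⟨ ∣p∪q∣≤∣p∣+∣q∣ ⁅ x ⁆ (fromList xs) ⟩
  ∣ ⁅ x ⁆ ∣ + ∣ fromList xs ∣     ≡⟨ cong (_+ _) (∣⁅x⁆∣≡1 x) ⟩
  suc ∣ fromList xs ∣             ≤⟨ s≤s (∣fromList∣≤length xs) ⟩
  suc (length xs)                 ∎
  where open ≤-Reasoning

∈-fromList⁺ : ∀ {m} {v : Fin m} xs → v ∈ xs → v ∈ₛ fromList xs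
∈-fromList⁺ {v = v} (_ ∷ _)  (here refl)  = x∈p∪q⁺ (inj₁ (x∈⁅x⁆ v))
∈-fromList⁺         (_ ∷ xs) (there v∈xs) = x∈p∪q⁺ (inj₂ (∈-fromList⁺ xs v∈xs))

elements : ∀ {m} → Subset m → List (Fin m)
elements []          = []
elements (true ∷ p)  = zero ∷ map suc (elements p)
elements (false ∷ p) = map suc (elements p)

length-elements : ∀ {m} (p : Subset m) → length (elements p) ≡ ∣ p ∣
length-elements []          = refl
length-elements (true ∷ p)  = cong suc (trans (length-map suc (elements p)) (length-elements p))
length-elements (false ∷ p) = trans (length-map suc (elements p)) (length-elements p)

∈-elements⁺ : ∀ {m} {v : Fin m} (p : Subset m) → v ∈ₛ p → v ∈ elements p
∈-elements⁺ {v = zero}  (true ∷ p)  _   = here refl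
∈-elements⁺ {v = suc v} (true ∷ p)  v∈p = there (∈-map⁺ suc (∈-elements⁺ p (drop-there v∈p)))
∈-elements⁺ {v = suc v} (false ∷ p) v∈p = ∈-map⁺ suc (∈-elements⁺ p (drop-there v∈p))

elements-Unique : ∀ {m} (p : Subset m) → Unique (elements p)
elements-Unique []          = []
elements-Unique (true ∷ p)  =
  All.map⁺ (All.universal (λ _ ()) (elements p)) ∷ Unique.map⁺ Fin.suc-injective (elements-Unique p)
elements-Unique (false ∷ p) = Unique.map⁺ Fin.suc-injective (elements-Unique p)

ColoredAt-mono : ∀ {m} {G : Graph m} {D : Orientation G} {S k l v} →
                 k ≤ l → ColoredAt D S k v → ColoredAt D S l v
ColoredAt-mono k≤l = go (≤⇒≤′ k≤l)
  where
  go : ∀ {G D S k l v} → k ≤′ l → ColoredAt {G = G} D S k v → ColoredAt D S l v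
  go (≤′-reflexive refl) colored = colored
  go (≤′-step k≤′l)      colored = keep (go k≤′l colored)

-- position xs v is length xs when v does not occur in xs
module Position {A : Set} (_≟_ : DecidableEquality A) where

  position : List A → A → ℕ
  position []       v = 0
  position (x ∷ xs) v with x ≟ v
  ... | yes _ = 0
  ... | no  _ = suc (position xs v)

  position-head : ∀ x xs → position (x ∷ xs) x ≡ 0
  position-head x xs with x ≟ x
  ... | yes _   = refl
  ... | no  x≢x = contradiction refl x≢x

  position-tail : ∀ {x v} xs → x ≢ v → position (x ∷ xs) v ≡ suc (position xs v)
  position-tail {x} {v} xs x≢v with x ≟ v
  ... | yes x≡v = contradiction x≡v x≢v
  ... | no  _   = refl

  position≡0 : ∀ {x v} xs → position (x ∷ xs) v ≡ 0 → x ≡ v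
  position≡0 {x} {v} xs _ with x ≟ v
  position≡0 xs _  | yes x≡v = x≡v
  position≡0 xs () | no _

  position-injective : ∀ {xs u v} → u ∈ xs → v ∈ xs → position xs u ≡ position xs v → u ≡ v
  position-injective {x ∷ xs} {u} {v} u∈ v∈ eq with x ≟ u | x ≟ v
  ... | yes x≡u | yes x≡v = trans (sym x≡u) x≡v
  position-injective (here u≡x)    _ _ | no x≢u | _      = contradiction (sym u≡x) x≢u
  position-injective _ (here v≡x)    _ | _      | no x≢v = contradiction (sym v≡x) x≢v
  position-injective (there u∈) (there v∈) eq | no _ | no _ = position-injective u∈ v∈ (suc-injective eq)

  position<length : ∀ {xs v} → v ∈ xs → position xs v < length xs
  position<length {x ∷ xs} {v} v∈ with x ≟ v
  ... | yes _ = s≤s z≤n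
  position<length (here v≡x)   | no x≢v = contradiction (sym v≡x) x≢v
  position<length (there v∈xs) | no _   = s≤s (position<length v∈xs)

module Runs {m : ℕ} (G : Graph m) where

  open Position (_≟ᶠ_ {m})

  V : Set
  V = Fin m

  breaks : V → List V → ℕ
  breaks x []       = 0
  breaks x (y ∷ ys) with adj G x y
  ... | true  = breaks y ys
  ... | false = suc (breaks y ys)

  runCount : List V → ℕ
  runCount []       = 0
  runCount (x ∷ xs) = suc (breaks x xs)

  breaks-++ : ∀ x xs ys → breaks x (xs ++ ys) ≤ breaks x xs + runCount ys
  breaks-++ x []       []       = z≤n
  breaks-++ x []       (y ∷ ys) with adj G x y
  ... | true  = n≤1+n _
  ... | false = ≤-refl
  breaks-++ x (z ∷ zs) ys       with adj G x z
  ... | true  = breaks-++ z zs ys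
  ... | false = s≤s (breaks-++ z zs ys)

  breaks-path : ∀ {x xs} → IsPath G (x ∷ xs) → breaks x xs ≡ 0
  breaks-path {xs = []}     _             = refl
  breaks-path {xs = y ∷ ys} (x~y ∷ path) rewrite x~y = breaks-path path

  runCount-concat : ∀ {ps} → All (IsPath G) ps → runCount (concat ps) ≤ length ps
  runCount-concat []                              = z≤n
  runCount-concat {[] ∷ _}             (() ∷ _)
  runCount-concat {(x ∷ xs) ∷ ps} (path ∷ paths) = s≤s (begin
    breaks x (xs ++ concat ps)          ≤⟨ breaks-++ x xs (concat ps) ⟩
    breaks x xs + runCount (concat ps)  ≡⟨ cong (_+ runCount (concat ps)) (breaks-path path) ⟩
    runCount (concat ps)                ≤⟨ runCount-concat paths ⟩
    length ps                           ∎)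
    where open ≤-Reasoning

  -- runs x xs = (r , rs): the runs of x ∷ xs are x ∷ r followed by rs
  runs : V → List V → List V × List (List V)
  runs x []       = [] , []
  runs x (y ∷ ys) with adj G x y | runs y ys
  ... | true  | r , rs = y ∷ r , rs
  ... | false | r , rs = [] , (y ∷ r) ∷ rs

  runCover : V → List V → List (List V)
  runCover x xs = let r , rs = runs x xs in (x ∷ r) ∷ rs

  concat-runs : ∀ x xs → let r , rs = runs x xs in r ++ concat rs ≡ xs
  concat-runs x []       = refl
  concat-runs x (y ∷ ys) with adj G x y | runs y ys | concat-runs y ys
  ... | true  | r , rs | eq = cong (y ∷_) eq
  ... | false | r , rs | eq = cong (y ∷_) eq

  length-runs : ∀ x xs → length (proj₂ (runs x xs)) ≡ breaks x xs
  length-runs x []       = refl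
  length-runs x (y ∷ ys) with adj G x y | runs y ys | length-runs y ys
  ... | true  | r , rs | eq = eq
  ... | false | r , rs | eq = cong suc eq

  runCover-paths : ∀ x xs → All (IsPath G) (runCover x xs)
  runCover-paths x []       = [-] ∷ []
  runCover-paths x (y ∷ ys) with adj G x y in x~y | runs y ys | runCover-paths y ys
  ... | true  | r , rs | path ∷ paths = (x~y ∷ path) ∷ paths
  ... | false | r , rs | paths        = [-] ∷ paths

  runCover-isPathCover : ∀ {x xs} → x ∷ xs ↭ allFin m → IsPathCover G (runCover x xs)
  runCover-isPathCover {x} {xs} perm =
    runCover-paths x xs , subst (_↭ allFin m) (cong (x ∷_) (sym (concat-runs x xs))) perm

  length-runCover : ∀ x xs → length (runCover x xs) ≡ runCount (x ∷ xs)
  length-runCover x xs = cong suc (length-runs x xs)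

  -- The redundant length condition makes the search over orderings finite.
  Achievable : ℕ → Set
  Achievable k = ∃ λ L → length L ≡ m × L ↭ allFin m × runCount L ≡ k

  achievable? : Decidable Achievable
  achievable? k = any-ofLength? (λ L → ↭-allFin? L ×-dec runCount L ≟ k) m

  achievable : ∀ {L} → L ↭ allFin m → Achievable (runCount L)
  achievable perm = _ , ↭-allFin⇒length perm , perm , refl

  minimalOrdering : ∃ λ L → L ↭ allFin m × (∀ {L′} → L′ ↭ allFin m → runCount L ≤ runCount L′)
  minimalOrdering with least achievable? _ (achievable ↭-refl)
  ... | _ , (L , _ , perm , refl) , minimal = L , perm , λ perm′ → minimal _ (achievable perm′)

  runStarts : V → List V → List V
  runStarts x []       = []
  runStarts x (y ∷ ys) with adj G x y
  ... | true  = runStarts y ys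
  ... | false = y ∷ runStarts y ys

  length-runStarts : ∀ x xs → length (runStarts x xs) ≡ breaks x xs
  length-runStarts x []       = refl
  length-runStarts x (y ∷ ys) with adj G x y
  ... | true  = length-runStarts y ys
  ... | false = cong suc (length-runStarts y ys)

  runStarts-⊆ : ∀ x y ys → runStarts y ys ⊆ runStarts x (y ∷ ys)
  runStarts-⊆ x y ys with adj G x y
  ... | true  = λ v∈ → v∈
  ... | false = there

  predecessor : ∀ x xs {v j} → Unique (x ∷ xs) → v ∈ xs → position (x ∷ xs) v ≡ suc j →
                ∃ λ u → u ∈ x ∷ xs × position (x ∷ xs) u ≡ j × (Edge G u v ⊎ v ∈ runStarts x xs)
  predecessor x (y ∷ ys) {v} {j} (x∉ ∷ unique) v∈ position-v =
    predecessor′ j v∈ (suc-injective (trans (sym (position-tail (y ∷ ys) (All.lookup x∉ v∈))) position-v))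
    where
    predecessor′ : ∀ j → v ∈ y ∷ ys → position (y ∷ ys) v ≡ j →
                   ∃ λ u → u ∈ x ∷ y ∷ ys × position (x ∷ y ∷ ys) u ≡ j × (Edge G u v ⊎ v ∈ runStarts x (y ∷ ys))
    predecessor′ zero _ position≡ with position≡0 ys position≡ | adj G x y in x~y
    ... | refl | true  = x , here refl , position-head x _ , inj₁ x~y
    ... | refl | false = x , here refl , position-head x _ , inj₂ (here refl)
    predecessor′ (suc j) (here refl) position≡ = contradiction (trans (sym (position-head v ys)) position≡) 0≢1+n
    predecessor′ (suc j) (there v∈ys) position≡ with predecessor y ys unique v∈ys position≡
    ... | u , u∈ , position-u , edge-or-start =
      u , there u∈ , trans (position-tail (y ∷ ys) (All.lookup x∉ u∈)) (cong suc position-u) ,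
      map₂ (runStarts-⊆ x y ys) edge-or-start

-- rankArc a b: an edge between ranks a and b points to b iff b = a + 1 or b + 1 < a
rankArc : ℕ → ℕ → Bool
rankArc zero          zero          = false
rankArc zero          (suc zero)    = true
rankArc zero          (suc (suc b)) = false
rankArc (suc a)       (suc b)       = rankArc a b
rankArc (suc zero)    zero          = false
rankArc (suc (suc a)) zero          = true

rankArc-suc : ∀ a → rankArc a (suc a) ≡ true
rankArc-suc zero    = refl
rankArc-suc (suc a) = rankArc-suc a

rankArc⇒ : ∀ a b → rankArc a b ≡ true → b ≡ suc a ⊎ b < a
rankArc⇒ zero          (suc zero) _ = inj₁ refl
rankArc⇒ (suc a)       (suc b)    a→b with rankArc⇒ a b a→b
... | inj₁ b≡1+a = inj₁ (cong suc b≡1+a)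
... | inj₂ b<a   = inj₂ (s≤s b<a)
rankArc⇒ (suc (suc a)) zero       _ = inj₂ (s≤s z≤n)

rankArc-exclusive : ∀ a b → a ≢ b →
                    (rankArc a b ≡ true × rankArc b a ≡ false) ⊎ (rankArc a b ≡ false × rankArc b a ≡ true)
rankArc-exclusive zero          zero          a≢b = contradiction refl a≢b
rankArc-exclusive zero          (suc zero)    _   = inj₁ (refl , refl)
rankArc-exclusive zero          (suc (suc b)) _   = inj₂ (refl , refl)
rankArc-exclusive (suc a)       (suc b)       a≢b = rankArc-exclusive a b (a≢b ∘ cong suc)
rankArc-exclusive (suc zero)    zero          _   = inj₂ (refl , refl)
rankArc-exclusive (suc (suc a)) zero          _   = inj₁ (refl , refl)

Edge⇒≢ : ∀ {m} (G : Graph m) {u v} → Edge G u v → u ≢ v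
Edge⇒≢ G {u} u~u refl = contradiction (trans (sym u~u) (adj-irr G u)) λ ()

orientBy : ∀ {m} (G : Graph m) (rank : Fin m → ℕ) → (∀ {u v} → rank u ≡ rank v → u ≡ v) → Orientation G
orientBy G rank rank-injective = record
  { arc         = λ u v → adj G u v ∧ rankArc (rank u) (rank v)
  ; arc-edge    = λ u v → Bool.∧-conicalˡ (adj G u v) _
  ; arc-one-dir = oneDirection
  }
  where
  oneDirection : ∀ u v → Edge G u v →
    (adj G u v ∧ rankArc (rank u) (rank v) ≡ true × adj G v u ∧ rankArc (rank v) (rank u) ≡ false) ⊎
    (adj G u v ∧ rankArc (rank u) (rank v) ≡ false × adj G v u ∧ rankArc (rank v) (rank u) ≡ true)
  oneDirection u v u~v rewrite u~v | trans (adj-sym G v u) u~v =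
    rankArc-exclusive (rank u) (rank v) (Edge⇒≢ G u~v ∘ rank-injective)

module Ordering {m : ℕ} (G : Graph m) {x₀ : Fin m} {xs : List (Fin m)} (perm : x₀ ∷ xs ↭ allFin m) where

  open Runs G
  open Position (_≟ᶠ_ {m})

  rank : Fin m → ℕ
  rank = position (x₀ ∷ xs)

  rank-injective : ∀ {u v} → rank u ≡ rank v → u ≡ v
  rank-injective = position-injective (↭-allFin⇒∈ perm _) (↭-allFin⇒∈ perm _)

  D : Orientation G
  D = orientBy G rank rank-injective

  starts : List (Fin m)
  starts = x₀ ∷ runStarts x₀ xs

  S : Subset m
  S = fromList starts

  ∣S∣≤runCount : ∣ S ∣ ≤ runCount (x₀ ∷ xs)
  ∣S∣≤runCount = ≤-trans (∣fromList∣≤length starts) (s≤s (≤-reflexive (length-runStarts x₀ xs)))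

  colored : ∀ j {v} → rank v ≡ j → ColoredAt D S j v
  colored = <-rec _ coloredAt
    where
    coloredAt : ∀ j → (∀ {i} → i < j → ∀ {v} → rank v ≡ i → ColoredAt D S i v) →
                ∀ {v} → rank v ≡ j → ColoredAt D S j v
    coloredAt zero    _       rank≡0 = init (subst (_∈ₛ S) (position≡0 xs rank≡0) (∈-fromList⁺ starts (here refl)))
    coloredAt (suc j) earlier {v} rank≡ with ↭-allFin⇒∈ perm v
    ... | here refl = contradiction (trans (sym (position-head x₀ xs)) rank≡) 0≢1+n
    ... | there v∈xs with predecessor x₀ xs (↭-allFin⇒Unique perm) v∈xs rank≡
    ...   | u , _ , rank-u , inj₂ start = ColoredAt-mono z≤n (init (∈-fromList⁺ starts (there start)))
    ...   | u , _ , rank-u , inj₁ u~v   = force (earlier ≤-refl rank-u) u→v othersColored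
      where
      u→v : Arc D u v
      u→v rewrite u~v | rank-u | rank≡ = rankArc-suc j
      othersColored : ∀ w → Arc D u w → w ≢ v → ColoredAt D S j w
      othersColored w u→w w≢v with rankArc⇒ (rank u) (rank w) (Bool.∧-conicalʳ (adj G u w) _ u→w)
      ... | inj₁ rank-w≡ = contradiction (rank-injective (trans rank-w≡ (trans (cong suc rank-u) (sym rank≡)))) w≢v
      ... | inj₂ w<u     = ColoredAt-mono (<⇒≤ w<j) (earlier (m<n⇒m<1+n w<j) refl)
        where
        w<j : rank w < j
        w<j = subst (rank w <_) rank-u w<u

  forcingSet : IsForcingSet D S
  forcingSet = (x₀ , ∈-fromList⁺ starts (here refl)) , length (x₀ ∷ xs) ,
               λ v → ColoredAt-mono (<⇒≤ (position<length (↭-allFin⇒∈ perm v))) (colored (rank v) refl)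

module ForcingChains {m : ℕ} {G : Graph m} (D : Orientation G) (S : Subset m) where

  Saturated : List (Fin m) → Fin m → Set
  Saturated X u = ∀ w → Arc D u w → w ∈ X

  -- A chain is kept with its most recently forced vertex first; all the others have already forced.
  SaturatedTail : List (Fin m) → List (Fin m) → Set
  SaturatedTail X []      = ⊤
  SaturatedTail X (_ ∷ r) = All (Saturated X) r

  Forceable : List (Fin m) → Fin m → Set
  Forceable X v = ∃ λ u → u ∈ X × Arc D u v × (∀ w → Arc D u w → w ≢ v → w ∈ X)

  Forceable? : ∀ X v → Dec (Forceable X v)
  Forceable? X v =
    any? λ u → _∈?_ _≟ᶠ_ u X ×-dec arc? u v ×-dec all? λ w → arc? u w →-dec ¬? (w ≟ᶠ v) →-dec _∈?_ _≟ᶠ_ w X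
    where
    arc? : ∀ u v → Dec (Arc D u v)
    arc? u v = arc D u v Bool.≟ true

  Forceable-mono : ∀ {X Y v} → X ⊆ Y → Forceable X v → Forceable Y v
  Forceable-mono X⊆Y (u , u∈X , u→v , others) = u , X⊆Y u∈X , u→v , λ w u→w w≢v → X⊆Y (others w u→w w≢v)

  SaturatedTail-mono : ∀ {X Y} → X ⊆ Y → ∀ p → SaturatedTail X p → SaturatedTail Y p
  SaturatedTail-mono X⊆Y []      _         = _
  SaturatedTail-mono X⊆Y (_ ∷ r) saturated = All.map (λ sat w u→w → X⊆Y (sat w u→w)) saturated

  record Chains : Set where
    field
      chains    : List (List (Fin m))
      paths     : All (IsPath G) chains
      disjoint  : Unique (concat chains)
      saturated : All (SaturatedTail (concat chains)) chains
      count     : length chains ≡ ∣ S ∣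

  open Chains

  covered : Chains → List (Fin m)
  covered c = concat (chains c)

  forcer-isHead : ∀ {ps u v} → All (SaturatedTail (concat ps)) ps →
                  u ∈ concat ps → Arc D u v → v ∉ concat ps →
                  ∃₂ λ as bs → ∃ λ r → ps ≡ as ++ (u ∷ r) ∷ bs
  forcer-isHead {ps} saturated u∈ u→v v∉ with ∈-concat⁻′ ps u∈
  ... | _ ∷ r , here refl , p∈ps = let as , bs , ps≡ = ∈-∃++ p∈ps in as , bs , r , ps≡
  ... | _ ∷ r , there u∈r , p∈ps = contradiction (All.lookup (All.lookup saturated p∈ps) u∈r _ u→v) v∉

  extend : (c : Chains) {v : Fin m} → v ∉ covered c → Forceable (covered c) v →
           ∃ λ c′ → covered c′ ↭ v ∷ covered c
  extend record { chains = ps ; paths = paths ; disjoint = disjoint ; saturated = saturated ; count = count }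
         {v} v∉ (u , u∈ , u→v , others)
    with forcer-isHead saturated u∈ u→v v∉
  ... | as , bs , r , refl = c′ , grown
    where
    grown : concat (as ++ (v ∷ u ∷ r) ∷ bs) ↭ v ∷ concat (as ++ (u ∷ r) ∷ bs)
    grown = concat-consAt as bs v (u ∷ r)

    old⊆new : concat (as ++ (u ∷ r) ∷ bs) ⊆ concat (as ++ (v ∷ u ∷ r) ∷ bs)
    old⊆new x∈ = ∈-resp-↭ (↭-sym grown) (there x∈)

    u-saturated : Saturated (concat (as ++ (v ∷ u ∷ r) ∷ bs)) u
    u-saturated w u→w with w ≟ᶠ v
    ... | yes refl = ∈-resp-↭ (↭-sym grown) (here refl)
    ... | no  w≢v  = old⊆new (others w u→w w≢v)

    c′ : Chains
    c′ = record
      { chains    = as ++ (v ∷ u ∷ r) ∷ bs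
      ; paths     = All-replaceAt as paths (trans (adj-sym G v u) (arc-edge D u v u→v) ∷ All-at as paths)
      ; disjoint  = Unique-resp-↭ (setoid (Fin m)) (↭⇒↭ₛ (↭-sym grown)) (¬Any⇒All¬ _ v∉ ∷ disjoint)
      ; saturated = All-replaceAt as (All.map (λ {p} → SaturatedTail-mono old⊆new p) saturated)
                      (u-saturated ∷ SaturatedTail-mono old⊆new (u ∷ r) (All-at as saturated))
      ; count     = trans (length-replaceAt as) count
      }

  absorb : (c : Chains) (v : Fin m) →
           ∃ λ c′ → covered c ⊆ covered c′ × (Forceable (covered c) v → v ∈ covered c′)
  absorb c v with _∈?_ _≟ᶠ_ v (covered c) | Forceable? (covered c) v
  ... | yes v∈ | _          = c , (λ x∈ → x∈) , λ _ → v∈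
  ... | no  v∉ | yes forced = let c′ , grown = extend c v∉ forced
                              in c′ , (λ x∈ → ∈-resp-↭ (↭-sym grown) (there x∈)) , λ _ → ∈-resp-↭ (↭-sym grown) (here refl)
  ... | no  _  | no ¬forced = c , (λ x∈ → x∈) , λ forced → contradiction forced ¬forced

  absorbAll : (c : Chains) (vs : List (Fin m)) →
              ∃ λ c′ → covered c ⊆ covered c′ × (∀ {v} → v ∈ vs → Forceable (covered c) v → v ∈ covered c′)
  absorbAll c []       = c , (λ x∈ → x∈) , λ ()
  absorbAll c (v ∷ vs) =
    let c₁ , c⊆c₁ , v∈c₁  = absorb c v
        c₂ , c₁⊆c₂ , vs∈c₂ = absorbAll c₁ vs
    in c₂ , (λ x∈ → c₁⊆c₂ (c⊆c₁ x∈)) ,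
       λ { (here refl) forced → c₁⊆c₂ (v∈c₁ forced)
         ; (there w∈)  forced → vs∈c₂ w∈ (Forceable-mono c⊆c₁ forced) }

  singletons : Chains
  singletons = record
    { chains    = map [_] (elements S)
    ; paths     = All.map⁺ (All.universal (λ _ → [-]) (elements S))
    ; disjoint  = subst Unique (sym (concat-map-[ elements S ])) (elements-Unique S)
    ; saturated = All.map⁺ (All.universal (λ _ → []) (elements S))
    ; count     = trans (length-map [_] (elements S)) (length-elements S)
    }

  replay : ∀ k → ∃ λ c → ∀ {v} → ColoredAt D S k v → v ∈ covered c
  replay zero = singletons , λ { (init v∈S) → subst (_ ∈_) (sym (concat-map-[ elements S ])) (∈-elements⁺ S v∈S) }
  replay (suc k) =
    let c , coloredₖ⊆c = replay k
        c′ , c⊆c′ , forced⊆c′ = absorbAll c (allFin m)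
    in c′ , λ { (keep colored) → c⊆c′ (coloredₖ⊆c colored)
              ; (force {u = u} colored u→v others) →
                  forced⊆c′ (∈-allFin _) (u , coloredₖ⊆c colored , u→v , λ w u→w w≢v → coloredₖ⊆c (others w u→w w≢v)) }

  forcingSet⇒pathCover : IsForcingSet D S → ∃ λ ps → IsPathCover G ps × length ps ≡ ∣ S ∣
  forcingSet⇒pathCover (_ , k , allColored) =
    let c , colored⊆c = replay k
    in chains c , (paths c , ↭-allFin⁺ (disjoint c) (λ v → colored⊆c (allColored v))) , count c

corollary3p6 : (n : ℕ) (G : Graph (suc n)) → Σ ℕ (λ k → IsMof G k × IsRho G k)
corollary3p6 n G with Runs.minimalOrdering G
... | []     , perm , _       = contradiction (↭-allFin⇒length perm) λ ()
... | x ∷ xs , perm , minimal = runCount (x ∷ xs) , (mof-attained , mof-least) , (ρ-attained , ρ-least)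
  where
  open Runs G

  ρ-least : ∀ ps → IsPathCover G ps → runCount (x ∷ xs) ≤ length ps
  ρ-least ps (paths , cover) = ≤-trans (minimal cover) (runCount-concat paths)

  mof-least : ∀ D S → IsForcingSet D S → runCount (x ∷ xs) ≤ ∣ S ∣
  mof-least D S forcing =
    let ps , cover , ps≡∣S∣ = ForcingChains.forcingSet⇒pathCover D S forcing
    in ≤-trans (ρ-least ps cover) (≤-reflexive ps≡∣S∣)

  ρ-attained : ∃ λ ps → IsPathCover G ps × length ps ≡ runCount (x ∷ xs)
  ρ-attained = runCover x xs , runCover-isPathCover perm , length-runCover x xs

  mof-attained : ∃₂ λ D S → IsForcingSet D S × ∣ S ∣ ≡ runCount (x ∷ xs)
  mof-attained = D , S , forcingSet , ≤-antisym ∣S∣≤runCount (mof-least D S forcingSet)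
    where open Ordering G perm
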